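{- Let $\mu$ be a partition and let $\lambda$ and $\nu$ be finite sequences of integers. Then the sequence with general term $$b_{\lambda,\,\mu+(n)}^{\nu+(|\lambda|\cdot n)} = \big\langle h_{\lambda}[s_{\mu+(n)}],\ h_{\nu+(|\lambda|\cdot n)}\big\rangle,\qquad n\ge0,$$ is eventually constant.
   Context: For a finite sequence of integers $\alpha=(\alpha_1,\dots,\alpha_k)$, $h_\alpha=h_{\alpha_1}\cdots h_{\alpha_k}$ where $h_r$ is the complete homogeneous symmetric function ($h_0=1$, $h_r=0$ for $r<0$). For a partition $\mu$ and finite sequences of integers $\lambda,\nu$, $b_{\lambda,\mu}^{\nu}=\langle h_\lambda[s_\mu],h_\nu\rangle$, where $s_\mu$ is the Schur function, $f[g]$ is plethysm and $\langle\cdot,\cdot\rangle$ is the Hall inner product. For a sequence (or partition) $\alpha$ and an integer $k$, $\alpha+(k)$ denotes $\alpha$ with $k$ added to its first entry. $|\lambda|=\sum_i\lambda_i$. -}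

module Defs where

open import Data.Nat as ℕ using (ℕ; zero; suc; _<_; _≥_; _>_)
open import Data.Integer as ℤ using (ℤ; +_; -[1+_])
open import Data.List as L using (List; []; _∷_; _++_; map; concatMap; filter; length; upTo; foldr)
open import Data.List.Relation.Unary.All using (All)
open import Data.List.Relation.Unary.Linked using (Linked)
open import Data.Vec as V using (Vec; zipWith; replicate; tabulate)
open import Data.Vec.Properties using (≡-dec)
open import Data.Fin using (Fin; toℕ)
open import Data.Maybe using (Maybe; just; nothing)
open import Data.Bool using (Bool; true; false; _∧_)
open import Relation.Nullary.Decidable using (⌊_⌋)
open import Relation.Binary.PropositionalEquality using (_≡_)

IsPartition : List ℕ → Set
IsPartition μ = Linked _≥_ μ × All (λ x → x > 0) μ
  where open import Data.Product using (_×_)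

addFirstℕ : List ℕ → ℕ → List ℕ
addFirstℕ []       k = k ∷ []
addFirstℕ (a ∷ as) k = (a ℕ.+ k) ∷ as

addFirstℤ : List ℤ → ℤ → List ℤ
addFirstℤ []       k = k ∷ []
addFirstℤ (a ∷ as) k = (a ℤ.+ k) ∷ as

sizeℤ : List ℤ → ℤ
sizeℤ = foldr ℤ._+_ (+ 0)

-- Polynomials in m variables with coefficients in ℕ, represented as a
-- multiset (list) of monomials (exponent vectors); the coefficient of a
-- monomial is its number of occurrences.

Mono : ℕ → Set
Mono m = Vec ℕ m

Poly : ℕ → Set
Poly m = List (Mono m)

one : ∀ {m} → Poly m
one = replicate _ 0 ∷ []

_*P_ : ∀ {m} → Poly m → Poly m → Poly m
f *P g = concatMap (λ a → map (zipWith ℕ._+_ a) g) f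

msets : ∀ {A : Set} → ℕ → List A → List (List A)
msets zero    _        = [] ∷ []
msets (suc r) []       = []
msets (suc r) (x ∷ xs) = map (x ∷_) (msets r (x ∷ xs)) ++ msets (suc r) xs

monoSum : ∀ {m} → List (Mono m) → Mono m
monoSum = foldr (zipWith ℕ._+_) (replicate _ 0)

-- plethysm h_r[f] for f a monomial-positive polynomial:
-- h_r evaluated at the monomials of f (with multiplicity).
hPleth : ∀ {m} → ℕ → Poly m → Poly m
hPleth r f = map monoSum (msets r f)

hPlethℤ : ∀ {m} → ℤ → Poly m → Poly m
hPlethℤ (+ r)    f = hPleth r f
hPlethℤ -[1+ _ ] f = []

hSeqPleth : ∀ {m} → List ℤ → Poly m → Poly m
hSeqPleth λs f = foldr (λ r acc → hPlethℤ r f *P acc) one λs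

-- Schur polynomial s_μ(x_1,…,x_m) as the sum over semistandard Young
-- tableaux of shape μ with entries in {0,…,m-1} of x^T.

-- weakly increasing rows of length k with entries < m
rows : ℕ → ℕ → List (List ℕ)
rows m k = msets k (upTo m)

fillings : ℕ → List ℕ → List (List (List ℕ))
fillings m []       = [] ∷ []
fillings m (k ∷ ks) = concatMap (λ r → map (r ∷_) (fillings m ks)) (rows m k)

colStrict : List ℕ → List ℕ → Bool
colStrict (a ∷ as) (b ∷ bs) = ⌊ a ℕ.<? b ⌋ ∧ colStrict as bs
colStrict _        _        = true

isSSYT : List (List ℕ) → Bool
isSSYT (r₁ ∷ r₂ ∷ rs) = colStrict r₁ r₂ ∧ isSSYT (r₂ ∷ rs)
isSSYT _              = true

ssyt : ℕ → List ℕ → List (List (List ℕ))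
ssyt m μ = filter (λ T → isSSYT T Data.Bool.≟ true) (fillings m μ)

countEntry : ℕ → List (List ℕ) → ℕ
countEntry i T = length (filter (ℕ._≟ i) (L.concat T))

content : ∀ m → List (List ℕ) → Mono m
content m T = tabulate (λ i → countEntry (toℕ i) T)

schur : ∀ m → List ℕ → Poly m
schur m μ = map (content m) (ssyt m μ)

-- Hall inner product with h_ν: ⟨f, h_ν⟩ is the coefficient of m_ν in f
-- (h and m are dual bases), i.e. the coefficient of x^ν in the
-- symmetric function f; it is 0 if ν has a negative entry (h_ν = 0).
-- Only the variables x_1,…,x_{ℓ(ν)} matter, so we work in m = ℓ(ν) variables.

toNatVec : ∀ {m} → Vec ℤ m → Maybe (Vec ℕ m)
toNatVec V.[] = just V.[]
toNatVec (+ a V.∷ v) with toNatVec v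
... | just w  = just (a V.∷ w)
... | nothing = nothing
toNatVec (-[1+ _ ] V.∷ v) = nothing

coeff : ∀ {m} → Poly m → Mono m → ℕ
coeff f a = length (filter (λ b → ≡-dec ℕ._≟_ b a) f)

plethCoeff : List ℤ → List ℕ → List ℤ → ℕ
plethCoeff λs μ ν with toNatVec (V.fromList ν)
... | nothing = 0
... | just a  = coeff (hSeqPleth λs (schur (length ν) μ)) a

EventuallyConstant : (ℕ → ℕ) → Set
EventuallyConstant b = Σ ℕ λ N → ∀ n → n ≥ N → b n ≡ b N
  where open import Data.Product using (Σ)

{-# OPTIONS --safe #-}
-- Write μ + (n) = (k, κ), L = |λ|, and let U = k + |κ| bound the x₁-degree of the monomials of
-- s_(k,κ) (the letter x₁ is the tableau entry 0). Call such a monomial near if its x₁-degree is at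
-- least U − D. Shortfalls in x₁-degree add up under products and under h_r[-], so the monomials of
-- h_λ[s_(k,κ)] of x₁-degree at least L·U − D only involve near monomials of s_(k,κ). Once
-- k ≥ D + |κ|, a near tableau has at least |κ| entries x₁ in its first row, so putting one more x₁
-- in front of that row keeps it semistandard; this is a bijection onto the near tableaux of shape
-- (k + 1, κ) and multiplies the monomial by x₁. Hence the coefficient of x₁^(a+L) x^w in
-- h_λ[s_(k+1,κ)] is that of x₁^a x^w in h_λ[s_(k,κ)]. Along the sequence of the theorem the
-- shortfall L·U − (ν₁ + L·n) does not depend on n, so a single D serves for all large n.
module Submission where

open import Defs
open import Data.Nat as ℕ using (ℕ; zero; suc; _+_; _∸_; _≤_; _<_; _≤?_; _<?_; _≟_; z≤n; s≤s; s≤s⁻¹; z<s)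
open import Data.Nat.Properties
open import Data.Nat.Tactic.RingSolver using (solve-∀)
open import Algebra.Properties.CommutativeSemigroup +-commutativeSemigroup using (interchange; xy∙z≈xz∙y; xy∙z≈zx∙y)
open import Data.Integer as ℤ using (ℤ; +_; -[1+_]; _*_)
import Data.Integer.Properties as ℤₚ
open import Data.List using (List; []; _∷_; _++_; map; concatMap; concat; filter; length; replicate; applyUpTo; upTo)
open import Data.Nat.ListAction using (sum)
import Data.List.Properties as Listₚ
open import Data.List.Membership.Propositional using (_∈_)
open import Data.List.Membership.Propositional.Properties using (∈-map⁻; ∈-++⁻; ∈-filter⁻)
open import Data.List.Relation.Unary.All as All using (All; []; _∷_; all?)
import Data.List.Relation.Unary.All.Properties as Allₚ
open import Data.List.Relation.Unary.Any using (here; there)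
open import Data.Vec as Vec using (Vec; _∷_; zipWith; head)
open import Data.Vec.Properties using (≡-dec; ∷-injective)
open import Data.Bool as Bool using (true; false; _∧_)
open import Data.Maybe using (just; nothing)
open import Data.Product using (∃; ∃₂; _×_; _,_; proj₁; proj₂)
open import Data.Sum using (_⊎_; inj₁; inj₂)
open import Function using (_∘_; _⇔_; mk⇔; Equivalence)
open import Function.Definitions using (Injective)
open import Relation.Nullary using (yes; no; does; ¬_)
open import Relation.Nullary.Decidable using (⌊_⌋)
open import Relation.Unary using (Decidable; _≐_)
open import Relation.Binary.PropositionalEquality
  using (_≡_; refl; sym; trans; cong; cong₂; subst; subst₂; module ≡-Reasoning)

private variable
  A B C : Set

module _ {P : B → Set} (P? : Decidable P) where

  filter-map : (f : A → B) (xs : List A) → filter P? (map f xs) ≡ map f (filter (P? ∘ f) xs)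
  filter-map f []       = refl
  filter-map f (x ∷ xs) with does (P? (f x))
  ... | true  = cong (f x ∷_) (filter-map f xs)
  ... | false = filter-map f xs

  filter-concatMap : (f : A → List B) (xs : List A) →
                     filter P? (concatMap f xs) ≡ concatMap (filter P? ∘ f) xs
  filter-concatMap f []       = refl
  filter-concatMap f (x ∷ xs) =
    trans (Listₚ.filter-++ P? (f x) (concatMap f xs)) (cong (filter P? (f x) ++_) (filter-concatMap f xs))

module _ {P Q : A → Set} (P? : Decidable P) (Q? : Decidable Q) where

  filter-filter-⊆ : ∀ {xs} → All (λ x → P x → Q x) xs → filter P? (filter Q? xs) ≡ filter P? xs
  filter-filter-⊆ {[]}     []           = refl
  filter-filter-⊆ {x ∷ xs} (P⇒Q ∷ P⇒Qs) with Q? x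
  ... | no ¬qx = trans (filter-filter-⊆ P⇒Qs) (sym (Listₚ.filter-reject P? (¬qx ∘ P⇒Q)))
  ... | yes _ with P? x
  ...   | yes _ = cong (x ∷_) (filter-filter-⊆ P⇒Qs)
  ...   | no _  = filter-filter-⊆ P⇒Qs

  filter-filter-≐ : ∀ {R : A → Set} (R? : Decidable R) {xs} → All (λ x → P x → Q x ⇔ R x) xs →
                    filter P? (filter Q? xs) ≡ filter P? (filter R? xs)
  filter-filter-≐ R? {[]}     []       = refl
  filter-filter-≐ R? {x ∷ xs} (e ∷ es) with Q? x | R? x
  ... | yes qx | no ¬rx =
    trans (Listₚ.filter-reject P? (λ px → ¬rx (Equivalence.to (e px) qx))) (filter-filter-≐ R? es)
  ... | no ¬qx | yes rx =
    trans (filter-filter-≐ R? es) (sym (Listₚ.filter-reject P? (λ px → ¬qx (Equivalence.from (e px) rx))))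
  ... | no _   | no _  = filter-filter-≐ R? es
  ... | yes _  | yes _ with P? x
  ...   | yes _ = cong (x ∷_) (filter-filter-≐ R? es)
  ...   | no _  = filter-filter-≐ R? es

concatMap-cong-local : ∀ {f g : A → List B} {xs} → All (λ x → f x ≡ g x) xs → concatMap f xs ≡ concatMap g xs
concatMap-cong-local = cong concat ∘ Listₚ.map-cong-local

concatMap-filter : ∀ {Q : A → Set} (Q? : Decidable Q) {f : A → List B} {xs} →
                   All (λ x → ¬ Q x → f x ≡ []) xs → concatMap f (filter Q? xs) ≡ concatMap f xs
concatMap-filter Q? {xs = []}         []       = refl
concatMap-filter Q? {f} {xs = x ∷ xs} (e ∷ es) with Q? x
... | yes _  = cong (f x ++_) (concatMap-filter Q? es)
... | no ¬qx = trans (concatMap-filter Q? es) (cong (_++ concatMap f xs) (sym (e ¬qx)))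

∈-concatMap-map⁻ : (f : A → B → C) (xs : List A) (ys : List B) {z : C} →
                   z ∈ concatMap (λ x → map (f x) ys) xs → ∃₂ λ x y → x ∈ xs × y ∈ ys × z ≡ f x y
∈-concatMap-map⁻ f (x ∷ xs) ys z∈ with ∈-++⁻ (map (f x) ys) z∈
... | inj₁ z∈fx with ∈-map⁻ (f x) z∈fx
...   | y , y∈ , refl = x , y , here refl , y∈ , refl
∈-concatMap-map⁻ f (x ∷ xs) ys z∈ | inj₂ z∈rest with ∈-concatMap-map⁻ f xs ys z∈rest
...   | x′ , y , x′∈ , y∈ , refl = x′ , y , there x′∈ , y∈ , refl

msets-length : ∀ r (xs : List A) → All (λ s → length s ≡ r) (msets r xs)
msets-length zero    xs       = refl ∷ []
msets-length (suc r) []       = []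
msets-length (suc r) (x ∷ xs) =
  Allₚ.++⁺ (Allₚ.map⁺ (All.map (cong suc) (msets-length r (x ∷ xs)))) (msets-length (suc r) xs)

msets-All : ∀ {P : A → Set} r {xs} → All P xs → All (All P) (msets r xs)
msets-All zero    _          = [] ∷ []
msets-All (suc r) []         = []
msets-All (suc r) (px ∷ pxs) =
  Allₚ.++⁺ (Allₚ.map⁺ (All.map (px ∷_) (msets-All r (px ∷ pxs)))) (msets-All (suc r) pxs)

msets-map : ∀ (f : A → B) r xs → msets r (map f xs) ≡ map (map f) (msets r xs)
msets-map f zero    xs       = refl
msets-map f (suc r) []       = refl
msets-map f (suc r) (x ∷ xs) = begin
    map (f x ∷_) (msets r (map f (x ∷ xs))) ++ msets (suc r) (map f xs)
  ≡⟨ cong₂ (λ M N → map (f x ∷_) M ++ N) (msets-map f r (x ∷ xs)) (msets-map f (suc r) xs) ⟩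
    map (f x ∷_) (map (map f) (msets r (x ∷ xs))) ++ map (map f) (msets (suc r) xs)
  ≡⟨ cong (_++ _) (trans (sym (Listₚ.map-∘ (msets r (x ∷ xs)))) (Listₚ.map-∘ (msets r (x ∷ xs)))) ⟩
    map (map f) (map (x ∷_) (msets r (x ∷ xs))) ++ map (map f) (msets (suc r) xs)
  ≡⟨ Listₚ.map-++ (map f) (map (x ∷_) (msets r (x ∷ xs))) (msets (suc r) xs) ⟨
    map (map f) (msets (suc r) (x ∷ xs)) ∎
  where open ≡-Reasoning

msets-filter : ∀ {Q : A → Set} (Q? : Decidable Q) r xs → msets r (filter Q? xs) ≡ filter (all? Q?) (msets r xs)
msets-filter Q? zero    xs       = refl
msets-filter Q? (suc r) []       = refl
msets-filter {Q = Q} Q? (suc r) (x ∷ xs)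
  with ih-first ← msets-filter Q? r (x ∷ xs) | ih-rest ← msets-filter Q? (suc r) xs | Q? x
... | no ¬qx = begin
    msets (suc r) (filter Q? xs)
  ≡⟨ ih-rest ⟩
    filter (all? Q?) (msets (suc r) xs)
  ≡⟨ cong (_++ _) (Listₚ.filter-none (all? Q?) (Allₚ.map⁺ (All.universal x-excluded (msets r (x ∷ xs))))) ⟨
    filter (all? Q?) (map (x ∷_) (msets r (x ∷ xs))) ++ filter (all? Q?) (msets (suc r) xs)
  ≡⟨ Listₚ.filter-++ (all? Q?) (map (x ∷_) (msets r (x ∷ xs))) (msets (suc r) xs) ⟨
    filter (all? Q?) (msets (suc r) (x ∷ xs)) ∎
  where
    open ≡-Reasoning
    x-excluded : ∀ s → ¬ All Q (x ∷ s)
    x-excluded _ (qx ∷ _) = ¬qx qx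
... | yes qx = begin
    map (x ∷_) (msets r (x ∷ filter Q? xs)) ++ msets (suc r) (filter Q? xs)
  ≡⟨ cong₂ (λ M N → map (x ∷_) M ++ N) ih-first ih-rest ⟩
    map (x ∷_) (filter (all? Q?) (msets r (x ∷ xs))) ++ filter (all? Q?) (msets (suc r) xs)
  ≡⟨ cong (_++ _) prepend-x ⟩
    filter (all? Q?) (map (x ∷_) (msets r (x ∷ xs))) ++ filter (all? Q?) (msets (suc r) xs)
  ≡⟨ Listₚ.filter-++ (all? Q?) (map (x ∷_) (msets r (x ∷ xs))) (msets (suc r) xs) ⟨
    filter (all? Q?) (msets (suc r) (x ∷ xs)) ∎
  where
    open ≡-Reasoning
    prepend-x : map (x ∷_) (filter (all? Q?) (msets r (x ∷ xs))) ≡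
                filter (all? Q?) (map (x ∷_) (msets r (x ∷ xs)))
    prepend-x = sym (trans (filter-map (all? Q?) (x ∷_) (msets r (x ∷ xs)))
      (cong (map (x ∷_)) (Listₚ.filter-≐ _ (all? Q?) (All.tail , (qx ∷_)) (msets r (x ∷ xs)))))

∈-msets-∷⁻ : ∀ {P : A → Set} {x xs} → All P xs → ∀ k {s} → s ∈ msets k (x ∷ xs) →
             ∃₂ λ z s′ → s ≡ replicate z x ++ s′ × All P s′
∈-msets-∷⁻ pxs zero    (here refl) = 0 , [] , refl , []
∈-msets-∷⁻ {x = x} {xs} pxs (suc k) s∈ with ∈-++⁻ (map (x ∷_) (msets k (x ∷ xs))) s∈
... | inj₂ s∈rest = 0 , _ , refl , All.lookup (msets-All (suc k) pxs) s∈rest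
... | inj₁ s∈x∷ with ∈-map⁻ (x ∷_) s∈x∷
...   | s₀ , s₀∈ , refl with ∈-msets-∷⁻ pxs k s₀∈
...     | z , s′ , refl , ps′ = suc z , s′ , refl , ps′

module _ {m : ℕ} {P Q R : Mono m → Set} (P? : Decidable P) (Q? : Decidable Q) (R? : Decidable R) where

  filter-*P : ∀ {X Y} → All (λ a → All (λ b → P (zipWith _+_ a b) → Q a × R b) Y) X →
              filter P? (X *P Y) ≡ filter P? (filter Q? X *P filter R? Y)
  filter-*P {X} {Y} h = begin
      filter P? (X *P Y)
    ≡⟨ push-filter X Y ⟩
      concatMap (survivors Y) X
    ≡⟨ concatMap-cong-local (All.map restrict-right h) ⟩
      concatMap (survivors (filter R? Y)) X
    ≡⟨ concatMap-filter Q? (All.map vanish-left h) ⟨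
      concatMap (survivors (filter R? Y)) (filter Q? X)
    ≡⟨ push-filter (filter Q? X) (filter R? Y) ⟨
      filter P? (filter Q? X *P filter R? Y) ∎
    where
      open ≡-Reasoning
      survivors : Poly m → Mono m → Poly m
      survivors Y a = map (zipWith _+_ a) (filter (P? ∘ zipWith _+_ a) Y)
      push-filter : ∀ X Y → filter P? (X *P Y) ≡ concatMap (survivors Y) X
      push-filter X Y =
        trans (filter-concatMap P? _ X) (Listₚ.concatMap-cong (λ a → filter-map P? (zipWith _+_ a) Y) X)
      restrict-right : ∀ {a} → All (λ b → P (zipWith _+_ a b) → Q a × R b) Y →
                       survivors Y a ≡ survivors (filter R? Y) a
      restrict-right ha = cong (map _) (sym (filter-filter-⊆ _ R? (All.map (proj₂ ∘_) ha)))
      vanish-left : ∀ {a} → All (λ b → P (zipWith _+_ a b) → Q a × R b) Y → ¬ Q a →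
                    survivors (filter R? Y) a ≡ []
      vanish-left ha ¬qa =
        cong (map _) (Listₚ.filter-none _ (All.map (λ hab → ¬qa ∘ proj₁ ∘ hab) (Allₚ.filter⁺ R? ha)))

deg₁ : ∀ {m} → Mono (suc m) → ℕ
deg₁ = head

Deg₁≤ : ∀ {m} → ℕ → Poly (suc m) → Set
Deg₁≤ B = All (λ c → deg₁ c ≤ B)

deg₁-zipWith : ∀ {m} (a b : Mono (suc m)) → deg₁ (zipWith _+_ a b) ≡ deg₁ a + deg₁ b
deg₁-zipWith (_ ∷ _) (_ ∷ _) = refl

module _ {m : ℕ} where

  deg₁-monoSum : ∀ {U} {s : List (Mono (suc m))} → Deg₁≤ U s → deg₁ (monoSum s) ≤ length s ℕ.* U
  deg₁-monoSum []                  = z≤n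
  deg₁-monoSum {s = c ∷ s} (c≤ ∷ s≤) =
    ≤-trans (≤-reflexive (deg₁-zipWith c (monoSum s))) (+-mono-≤ c≤ (deg₁-monoSum s≤))

  *P-Deg₁≤ : ∀ {A B} {X Y : Poly (suc m)} → Deg₁≤ A X → Deg₁≤ B Y → Deg₁≤ (A + B) (X *P Y)
  *P-Deg₁≤ X≤ Y≤ = Allₚ.concat⁺ (Allₚ.map⁺ (All.map (λ {a} a≤ → Allₚ.map⁺ (All.map (λ {b} b≤ →
    ≤-trans (≤-reflexive (deg₁-zipWith a b)) (+-mono-≤ a≤ b≤)) Y≤)) X≤))

  hPleth-Deg₁≤ : ∀ r {U} {f : Poly (suc m)} → Deg₁≤ U f → Deg₁≤ (r ℕ.* U) (hPleth r f)
  hPleth-Deg₁≤ r {U} {f} f≤ = Allₚ.map⁺ (All.zipWith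
    (λ (len , s≤) → subst (λ l → _ ≤ l ℕ.* U) len (deg₁-monoSum s≤))
    (msets-length r f , msets-All r f≤))

  hSeqPleth-Deg₁≤ : ∀ ls {U} {f : Poly (suc m)} → Deg₁≤ U f → Deg₁≤ (sum ls ℕ.* U) (hSeqPleth (map +_ ls) f)
  hSeqPleth-Deg₁≤ []       f≤ = z≤n ∷ []
  hSeqPleth-Deg₁≤ (r ∷ ls) {U} f≤ rewrite *-distribʳ-+ U r (sum ls) =
    *P-Deg₁≤ (hPleth-Deg₁≤ r f≤) (hSeqPleth-Deg₁≤ ls f≤)

infixr 7 x₁^_·_

x₁^_·_ : ∀ {m} → ℕ → Mono (suc m) → Mono (suc m)
x₁^ k · (e ∷ es) = (k + e) ∷ es

x₁^-injective : ∀ {m} k → Injective _≡_ _≡_ (x₁^_·_ {m} k)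
x₁^-injective k {_ ∷ _} {_ ∷ _} eq with ∷-injective eq
... | k+e≡k+e′ , refl = cong (_∷ _) (+-cancelˡ-≡ k _ _ k+e≡k+e′)

module _ {m : ℕ} where

  zipWith-x₁^ : ∀ k l (a b : Mono (suc m)) → zipWith _+_ (x₁^ k · a) (x₁^ l · b) ≡ x₁^ (k + l) · zipWith _+_ a b
  zipWith-x₁^ k l (e ∷ a) (f ∷ b) = cong (_∷ zipWith _+_ a b) (interchange k e l f)

  monoSum-x₁^ : (s : List (Mono (suc m))) → monoSum (map (x₁^ 1 ·_) s) ≡ x₁^ length s · monoSum s
  monoSum-x₁^ []      = refl
  monoSum-x₁^ (c ∷ s) = trans (cong (zipWith _+_ (x₁^ 1 · c)) (monoSum-x₁^ s)) (zipWith-x₁^ 1 (length s) c (monoSum s))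

  hPleth-x₁^ : ∀ r (f : Poly (suc m)) → hPleth r (map (x₁^ 1 ·_) f) ≡ map (x₁^ r ·_) (hPleth r f)
  hPleth-x₁^ r f = begin
      map monoSum (msets r (map (x₁^ 1 ·_) f))
    ≡⟨ cong (map monoSum) (msets-map (x₁^ 1 ·_) r f) ⟩
      map monoSum (map (map (x₁^ 1 ·_)) (msets r f))
    ≡⟨ Listₚ.map-∘ (msets r f) ⟨
      map (monoSum ∘ map (x₁^ 1 ·_)) (msets r f)
    ≡⟨ Listₚ.map-cong-local (All.map (λ {s} len → trans (monoSum-x₁^ s) (cong (x₁^_· monoSum s) len))
                                     (msets-length r f)) ⟩
      map ((x₁^ r ·_) ∘ monoSum) (msets r f)
    ≡⟨ Listₚ.map-∘ (msets r f) ⟩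
      map (x₁^ r ·_) (hPleth r f) ∎
    where open ≡-Reasoning

  *P-x₁^ : ∀ k l (X Y : Poly (suc m)) → map (x₁^ k ·_) X *P map (x₁^ l ·_) Y ≡ map (x₁^ (k + l) ·_) (X *P Y)
  *P-x₁^ k l X Y = begin
      concatMap (λ a → map (zipWith _+_ a) (map (x₁^ l ·_) Y)) (map (x₁^ k ·_) X)
    ≡⟨ Listₚ.concatMap-map _ (x₁^ k ·_) X ⟩
      concatMap (λ a → map (zipWith _+_ (x₁^ k · a)) (map (x₁^ l ·_) Y)) X
    ≡⟨ Listₚ.concatMap-cong (λ a → trans (sym (Listₚ.map-∘ Y))
                                         (trans (Listₚ.map-cong (zipWith-x₁^ k l a) Y) (Listₚ.map-∘ Y))) X ⟩
      concatMap (λ a → map (x₁^ (k + l) ·_) (map (zipWith _+_ a) Y)) X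
    ≡⟨ Listₚ.map-concatMap (x₁^ (k + l) ·_) _ X ⟨
      map (x₁^ (k + l) ·_) (X *P Y) ∎
    where open ≡-Reasoning

  hSeqPleth-x₁^ : ∀ ls (f : Poly (suc m)) →
                  hSeqPleth (map +_ ls) (map (x₁^ 1 ·_) f) ≡ map (x₁^ sum ls ·_) (hSeqPleth (map +_ ls) f)
  hSeqPleth-x₁^ []       f = refl
  hSeqPleth-x₁^ (r ∷ ls) f =
    trans (cong₂ _*P_ (hPleth-x₁^ r f) (hSeqPleth-x₁^ ls f))
          (*P-x₁^ r (sum ls) (hPleth r f) (hSeqPleth (map +_ ls) f))

coeff-map-injective : ∀ {m} {f : Mono m → Mono m} → Injective _≡_ _≡_ f → ∀ P t → coeff (map f P) (f t) ≡ coeff P t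
coeff-map-injective {f = f} f-injective P t = begin
    length (filter (λ b → ≡-dec _≟_ b (f t)) (map f P))
  ≡⟨ cong length (filter-map (λ b → ≡-dec _≟_ b (f t)) f P) ⟩
    length (map f (filter (λ b → ≡-dec _≟_ (f b) (f t)) P))
  ≡⟨ Listₚ.length-map f (filter (λ b → ≡-dec _≟_ (f b) (f t)) P) ⟩
    length (filter (λ b → ≡-dec _≟_ (f b) (f t)) P)
  ≡⟨ cong length (Listₚ.filter-≐ _ _ (f-injective , cong f) P) ⟩
    coeff P t ∎
  where open ≡-Reasoning

coeff-filter : ∀ {m} {Q : Mono m → Set} (Q? : Decidable Q) P {t} → Q t → coeff (filter Q? P) t ≡ coeff P t
coeff-filter {Q = Q} Q? P {t} qt =
  cong length (filter-filter-⊆ (λ b → ≡-dec _≟_ b t) Q? (All.universal (λ b b≡t → subst Q (sym b≡t) qt) P))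

zeros : List ℕ → ℕ
zeros xs = length (filter (_≟ 0) xs)

zeros-++ : ∀ xs ys → zeros (xs ++ ys) ≡ zeros xs + zeros ys
zeros-++ xs ys = trans (cong length (Listₚ.filter-++ (_≟ 0) xs ys)) (Listₚ.length-++ (filter (_≟ 0) xs))

zeros-positive : ∀ {xs} → All (0 <_) xs → zeros xs ≡ 0
zeros-positive pos = cong length (Listₚ.filter-none (_≟ 0) (All.map (λ 0<x x≡0 → <-irrefl (sym x≡0) 0<x) pos))

zeros-replicate-++ : ∀ z {xs} → All (0 <_) xs → ∀ ys → zeros ((replicate z 0 ++ xs) ++ ys) ≡ z + zeros ys
zeros-replicate-++ zero    {xs} pos ys = trans (zeros-++ xs ys) (cong (_+ zeros ys) (zeros-positive pos))
zeros-replicate-++ (suc z) pos ys = cong suc (zeros-replicate-++ z pos ys)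

positive : ∀ m → All (0 <_) (applyUpTo suc m)
positive m = Allₚ.applyUpTo⁺₂ suc m (λ _ → z<s)

prependZero : List (List ℕ) → List (List ℕ)
prependZero []         = (0 ∷ []) ∷ []
prependZero (r ∷ rest) = (0 ∷ r) ∷ rest

content-prependZero : ∀ m T → content (suc m) (prependZero T) ≡ x₁^ 1 · content (suc m) T
content-prependZero m []      = refl
content-prependZero m (_ ∷ _) = refl

fillings-size : ∀ m μ {T} → T ∈ fillings m μ → length (concat T) ≡ sum μ
fillings-size m []       (here refl) = refl
fillings-size m (k ∷ ks) T∈ with ∈-concatMap-map⁻ _∷_ (rows m k) (fillings m ks) T∈
... | r , rest , r∈ , rest∈ , refl =
  trans (Listₚ.length-++ r) (cong₂ _+_ (All.lookup (msets-length k (upTo m)) r∈) (fillings-size m ks rest∈))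

zeros-≤-size : ∀ m μ {T} → T ∈ fillings m μ → zeros (concat T) ≤ sum μ
zeros-≤-size m μ {T} T∈ = subst (zeros (concat T) ≤_) (fillings-size m μ T∈) (Listₚ.length-filter (_≟ 0) (concat T))

schur-Deg₁≤ : ∀ m μ → Deg₁≤ (sum μ) (schur (suc m) μ)
schur-Deg₁≤ m μ = Allₚ.map⁺ (All.tabulate (zeros-≤-size (suc m) μ ∘ proj₁ ∘ ∈-filter⁻ _))

fillingsFrom : ℕ → List (List ℕ) → List ℕ → List (List (List ℕ))
fillingsFrom m rs ks = concatMap (λ r → map (r ∷_) (fillings m ks)) rs

fillings-suc : ∀ m k ks →
  fillings (suc m) (suc k ∷ ks) ≡
  map prependZero (fillings (suc m) (k ∷ ks)) ++ fillingsFrom (suc m) (msets (suc k) (applyUpTo suc m)) ks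
fillings-suc m k ks = begin
    concatMap withRow (map (0 ∷_) rows₀ ++ rows₊)
  ≡⟨ Listₚ.concatMap-++ withRow (map (0 ∷_) rows₀) rows₊ ⟩
    concatMap withRow (map (0 ∷_) rows₀) ++ concatMap withRow rows₊
  ≡⟨ cong (_++ concatMap withRow rows₊) (Listₚ.concatMap-map withRow (0 ∷_) rows₀) ⟩
    concatMap (withRow ∘ (0 ∷_)) rows₀ ++ concatMap withRow rows₊
  ≡⟨ cong (_++ concatMap withRow rows₊) (Listₚ.concatMap-cong prepend-row rows₀) ⟩
    concatMap (map prependZero ∘ withRow) rows₀ ++ concatMap withRow rows₊
  ≡⟨ cong (_++ concatMap withRow rows₊) (Listₚ.map-concatMap prependZero withRow rows₀) ⟨
    map prependZero (fillings (suc m) (k ∷ ks)) ++ concatMap withRow rows₊ ∎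
  where
    open ≡-Reasoning
    rows₀ rows₊ : List (List ℕ)
    rows₀ = msets k (0 ∷ applyUpTo suc m)
    rows₊ = msets (suc k) (applyUpTo suc m)
    withRow : List ℕ → List (List (List ℕ))
    withRow r = map (r ∷_) (fillings (suc m) ks)
    prepend-row : ∀ r → withRow (0 ∷ r) ≡ map prependZero (withRow r)
    prepend-row r = Listₚ.map-∘ {g = prependZero} {f = r ∷_} (fillings (suc m) ks)

colStrict-[] : ∀ r → colStrict r [] ≡ true
colStrict-[] []      = refl
colStrict-[] (_ ∷ _) = refl

colStrict-prependZero : ∀ z r r₂ → length r₂ ≤ z →
                        colStrict (0 ∷ replicate z 0 ++ r) r₂ ≡ colStrict (replicate z 0 ++ r) r₂
colStrict-prependZero z       r []       _          = sym (colStrict-[] (replicate z 0 ++ r))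
colStrict-prependZero (suc z) r (b ∷ r₂) (s≤s r₂≤z) = cong (⌊ 0 <? b ⌋ ∧_) (colStrict-prependZero z r r₂ r₂≤z)

isSSYT-prependZero : ∀ z r rest → length (concat rest) ≤ z →
                     isSSYT (prependZero ((replicate z 0 ++ r) ∷ rest)) ≡ isSSYT ((replicate z 0 ++ r) ∷ rest)
isSSYT-prependZero z r []          _   = refl
isSSYT-prependZero z r (r₂ ∷ rest) ≤z =
  cong (_∧ isSSYT (r₂ ∷ rest)) (colStrict-prependZero z r r₂ (≤-trans (Listₚ.length-++-≤ˡ r₂) ≤z))

ssyt? : Decidable (λ T → isSSYT T ≡ true)
ssyt? T = isSSYT T Bool.≟ true

module Nearness {m : ℕ} (D : ℕ) where

  Near : ℕ → Mono (suc m) → Set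
  Near B c = B ≤ deg₁ c + D

  near? : ∀ B → Decidable (Near B)
  near? B c = B ≤? deg₁ c + D

  near-split : ∀ {A B} (a b : Mono (suc m)) → deg₁ a ≤ A → deg₁ b ≤ B →
               Near (A + B) (zipWith _+_ a b) → Near A a × Near B b
  near-split {A} {B} a b a≤ b≤ near =
      +-cancelʳ-≤ B A (x + D) (begin
        A + B          ≤⟨ near′ ⟩
        x + y + D      ≡⟨ xy∙z≈xz∙y x y D ⟩
        x + D + y      ≤⟨ +-monoʳ-≤ (x + D) b≤ ⟩
        x + D + B      ∎)
    , +-cancelˡ-≤ A B (y + D) (begin
        A + B          ≤⟨ near′ ⟩
        x + y + D      ≡⟨ +-assoc x y D ⟩
        x + (y + D)    ≤⟨ +-monoˡ-≤ (y + D) a≤ ⟩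
        A + (y + D)    ∎)
    where
      open ≤-Reasoning
      x = deg₁ a
      y = deg₁ b
      near′ : A + B ≤ x + y + D
      near′ = subst (λ d → A + B ≤ d + D) (deg₁-zipWith a b) near

  near-monoSum : ∀ {U} {s : List (Mono (suc m))} → Deg₁≤ U s → Near (length s ℕ.* U) (monoSum s) → All (Near U) s
  near-monoSum []                  _    = []
  near-monoSum {s = c ∷ s} (c≤ ∷ s≤) near with near-split c (monoSum s) c≤ (deg₁-monoSum s≤) near
  ... | near-c , near-s = near-c ∷ near-monoSum s≤ near-s

  near-*P : ∀ {A B} {X Y : Poly (suc m)} → Deg₁≤ A X → Deg₁≤ B Y →
            filter (near? (A + B)) (X *P Y) ≡ filter (near? (A + B)) (filter (near? A) X *P filter (near? B) Y)
  near-*P X≤ Y≤ = filter-*P _ _ _ (All.map (λ {a} a≤ → All.map (λ {b} → near-split a b a≤) Y≤) X≤)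

  near-hPleth : ∀ r {U} {f : Poly (suc m)} → Deg₁≤ U f →
                filter (near? (r ℕ.* U)) (hPleth r f) ≡ filter (near? (r ℕ.* U)) (hPleth r (filter (near? U) f))
  near-hPleth r {U} {f} f≤ = begin
      filter N? (map monoSum (msets r f))
    ≡⟨ filter-map N? monoSum (msets r f) ⟩
      map monoSum (filter (N? ∘ monoSum) (msets r f))
    ≡⟨ cong (map monoSum) (filter-filter-⊆ (N? ∘ monoSum) (all? (near? U)) near-factors) ⟨
      map monoSum (filter (N? ∘ monoSum) (filter (all? (near? U)) (msets r f)))
    ≡⟨ cong (map monoSum ∘ filter (N? ∘ monoSum)) (msets-filter (near? U) r f) ⟨
      map monoSum (filter (N? ∘ monoSum) (msets r (filter (near? U) f)))
    ≡⟨ filter-map N? monoSum (msets r (filter (near? U) f)) ⟨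
      filter N? (hPleth r (filter (near? U) f)) ∎
    where
      open ≡-Reasoning
      N? = near? (r ℕ.* U)
      near-factors : All (λ s → Near (r ℕ.* U) (monoSum s) → All (Near U) s) (msets r f)
      near-factors = All.zipWith
        (λ {s} (len , s≤) near → near-monoSum s≤ (subst (λ l → Near (l ℕ.* U) (monoSum s)) (sym len) near))
        (msets-length r f , msets-All r f≤)

  near-hSeqPleth : ∀ ls {U} {f : Poly (suc m)} → Deg₁≤ U f →
                   filter (near? (sum ls ℕ.* U)) (hSeqPleth (map +_ ls) f) ≡
                   filter (near? (sum ls ℕ.* U)) (hSeqPleth (map +_ ls) (filter (near? U) f))
  near-hSeqPleth []       f≤ = refl
  near-hSeqPleth (r ∷ ls) {U} {f} f≤ rewrite *-distribʳ-+ U r (sum ls) = begin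
      filter N? (hPleth r f *P H f)
    ≡⟨ near-*P (hPleth-Deg₁≤ r f≤) (hSeqPleth-Deg₁≤ ls f≤) ⟩
      filter N? (filter (near? (r ℕ.* U)) (hPleth r f) *P filter (near? (sum ls ℕ.* U)) (H f))
    ≡⟨ cong₂ (λ X Y → filter N? (X *P Y)) (near-hPleth r f≤) (near-hSeqPleth ls f≤) ⟩
      filter N? (filter (near? (r ℕ.* U)) (hPleth r f′) *P filter (near? (sum ls ℕ.* U)) (H f′))
    ≡⟨ near-*P (hPleth-Deg₁≤ r f′≤) (hSeqPleth-Deg₁≤ ls f′≤) ⟨
      filter N? (hPleth r f′ *P H f′) ∎
    where
      open ≡-Reasoning
      N? = near? (r ℕ.* U + sum ls ℕ.* U)
      H : Poly (suc m) → Poly (suc m)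
      H = hSeqPleth (map +_ ls)
      f′ = filter (near? U) f
      f′≤ = Allₚ.filter⁺ (near? U) f≤

  coeff-near : ∀ ls {U} {f : Poly (suc m)} {t} → Deg₁≤ U f → Near (sum ls ℕ.* U) t →
               coeff (hSeqPleth (map +_ ls) f) t ≡ coeff (hSeqPleth (map +_ ls) (filter (near? U) f)) t
  coeff-near ls {U} {f} {t} f≤ near = begin
      coeff (H f) t
    ≡⟨ coeff-filter N? (H f) near ⟨
      coeff (filter N? (H f)) t
    ≡⟨ cong (λ P → coeff P t) (near-hSeqPleth ls f≤) ⟩
      coeff (filter N? (H (filter (near? U) f))) t
    ≡⟨ coeff-filter N? (H (filter (near? U) f)) near ⟩
      coeff (H (filter (near? U) f)) t ∎
    where
      open ≡-Reasoning
      N? = near? (sum ls ℕ.* U)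
      H : Poly (suc m) → Poly (suc m)
      H = hSeqPleth (map +_ ls)

  nonzeroFirstRow-far : ∀ k ks {T} → D + sum ks ≤ k → T ∈ fillingsFrom (suc m) (msets (suc k) (applyUpTo suc m)) ks →
                        ¬ Near (suc k + sum ks) (content (suc m) T)
  nonzeroFirstRow-far k ks D+S≤k T∈ near
    with ∈-concatMap-map⁻ _∷_ (msets (suc k) (applyUpTo suc m)) (fillings (suc m) ks) T∈
  ... | r , rest , r∈ , rest∈ , refl = <-irrefl refl (begin-strict
      k                             <⟨ n<1+n k ⟩
      suc k                         ≤⟨ m≤m+n (suc k) (sum ks) ⟩
      suc k + sum ks                ≤⟨ near ⟩
      zeros (r ++ concat rest) + D  ≡⟨ cong (_+ D) (zeros-replicate-++ 0 r-positive (concat rest)) ⟩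
      zeros (concat rest) + D       ≤⟨ +-monoˡ-≤ D (zeros-≤-size (suc m) ks rest∈) ⟩
      sum ks + D                    ≡⟨ +-comm (sum ks) D ⟩
      D + sum ks                    ≤⟨ D+S≤k ⟩
      k                             ∎)
    where
      open ≤-Reasoning
      r-positive : All (0 <_) r
      r-positive = All.lookup (msets-All (suc k) (positive m)) r∈

  isSSYT-prependZero-near : ∀ k ks {T} → D + sum ks ≤ k → T ∈ fillings (suc m) (k ∷ ks) →
                            Near (k + sum ks) (content (suc m) T) → isSSYT (prependZero T) ≡ isSSYT T
  isSSYT-prependZero-near k ks D+S≤k T∈ near
    with ∈-concatMap-map⁻ _∷_ (rows (suc m) k) (fillings (suc m) ks) T∈
  ... | r , rest , r∈ , rest∈ , refl with ∈-msets-∷⁻ (positive m) k r∈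
  ...   | z , r′ , refl , r′-positive =
    isSSYT-prependZero z r′ rest (subst (_≤ z) (sym (fillings-size (suc m) ks rest∈))
                                        (enough-zeros D+S≤k (zeros-≤-size (suc m) ks rest∈) near′))
    where
      near′ : k + sum ks ≤ z + zeros (concat rest) + D
      near′ = subst (λ d → k + sum ks ≤ d + D) (zeros-replicate-++ z r′-positive (concat rest)) near
      enough-zeros : ∀ {S c} → D + S ≤ k → c ≤ S → k + S ≤ z + c + D → S ≤ z
      enough-zeros {S} {c} D+S≤k c≤S near = +-cancelˡ-≤ D S z (+-cancelʳ-≤ S (D + S) (D + z) (begin
        D + S + S    ≤⟨ +-monoˡ-≤ S D+S≤k ⟩
        k + S        ≤⟨ near ⟩
        z + c + D    ≤⟨ +-monoˡ-≤ D (+-monoʳ-≤ z c≤S) ⟩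
        z + S + D    ≡⟨ xy∙z≈zx∙y z S D ⟩
        D + z + S    ∎))
        where open ≤-Reasoning

  schur-near-suc : ∀ k ks → D + sum ks ≤ k →
                   filter (near? (suc k + sum ks)) (schur (suc m) (suc k ∷ ks)) ≡
                   map (x₁^ 1 ·_) (filter (near? (k + sum ks)) (schur (suc m) (k ∷ ks)))
  schur-near-suc k ks D+S≤k = begin
      filter N′? (map cont (filter ssyt? (fillings (suc m) (suc k ∷ ks))))
    ≡⟨ cong (filter N′? ∘ map cont ∘ filter ssyt?) (fillings-suc m k ks) ⟩
      filter N′? (map cont (filter ssyt? (map prependZero F ++ F₊)))
    ≡⟨ cong (filter N′? ∘ map cont) (Listₚ.filter-++ ssyt? (map prependZero F) F₊) ⟩
      filter N′? (map cont (filter ssyt? (map prependZero F) ++ filter ssyt? F₊))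
    ≡⟨ cong (filter N′?) (Listₚ.map-++ cont (filter ssyt? (map prependZero F)) (filter ssyt? F₊)) ⟩
      filter N′? (map cont (filter ssyt? (map prependZero F)) ++ map cont (filter ssyt? F₊))
    ≡⟨ Listₚ.filter-++ N′? (map cont (filter ssyt? (map prependZero F))) (map cont (filter ssyt? F₊)) ⟩
      filter N′? (map cont (filter ssyt? (map prependZero F))) ++ filter N′? (map cont (filter ssyt? F₊))
    ≡⟨ cong (filter N′? (map cont (filter ssyt? (map prependZero F))) ++_) (Listₚ.filter-none N′? F₊-far) ⟩
      filter N′? (map cont (filter ssyt? (map prependZero F))) ++ []
    ≡⟨ Listₚ.++-identityʳ _ ⟩
      filter N′? (map cont (filter ssyt? (map prependZero F)))
    ≡⟨ cong (filter N′? ∘ map cont) (filter-map ssyt? prependZero F) ⟩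
      filter N′? (map cont (map prependZero F₀))
    ≡⟨ cong (filter N′?) cont-prependZero ⟩
      filter N′? (map (x₁^ 1 ·_) (map cont F₀))
    ≡⟨ filter-map N′? (x₁^ 1 ·_) (map cont F₀) ⟩
      map (x₁^ 1 ·_) (filter (N′? ∘ (x₁^ 1 ·_)) (map cont F₀))
    ≡⟨ cong (map (x₁^ 1 ·_)) (Listₚ.filter-≐ (N′? ∘ (x₁^ 1 ·_)) N? near-x₁ (map cont F₀)) ⟩
      map (x₁^ 1 ·_) (filter N? (map cont F₀))
    ≡⟨ cong (map (x₁^ 1 ·_)) (filter-map N? cont F₀) ⟩
      map (x₁^ 1 ·_) (map cont (filter (N? ∘ cont) (filter (ssyt? ∘ prependZero) F)))
    ≡⟨ cong (map (x₁^ 1 ·_) ∘ map cont)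
            (filter-filter-≐ (N? ∘ cont) (ssyt? ∘ prependZero) ssyt? (All.tabulate ssyt-prependZero)) ⟩
      map (x₁^ 1 ·_) (map cont (filter (N? ∘ cont) (filter ssyt? F)))
    ≡⟨ cong (map (x₁^ 1 ·_)) (filter-map N? cont (filter ssyt? F)) ⟨
      map (x₁^ 1 ·_) (filter N? (schur (suc m) (k ∷ ks))) ∎
    where
      open ≡-Reasoning
      U = k + sum ks
      N? = near? U
      N′? = near? (suc U)
      cont = content (suc m)
      F = fillings (suc m) (k ∷ ks)
      F₊ = fillingsFrom (suc m) (msets (suc k) (applyUpTo suc m)) ks
      F₀ = filter (ssyt? ∘ prependZero) F
      F₊-far : All (λ c → ¬ Near (suc U) c) (map cont (filter ssyt? F₊))
      F₊-far = Allₚ.map⁺ (Allₚ.filter⁺ ssyt? (All.tabulate (nonzeroFirstRow-far k ks D+S≤k)))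
      cont-prependZero : map cont (map prependZero F₀) ≡ map (x₁^ 1 ·_) (map cont F₀)
      cont-prependZero =
        trans (sym (Listₚ.map-∘ F₀)) (trans (Listₚ.map-cong (content-prependZero m) F₀) (Listₚ.map-∘ F₀))
      near-x₁ : (λ c → Near (suc U) (x₁^ 1 · c)) ≐ Near U
      near-x₁ = (λ { {_ ∷ _} → s≤s⁻¹ }) , (λ { {_ ∷ _} → s≤s })
      ssyt-prependZero : ∀ {T} → T ∈ F → Near U (cont T) → isSSYT (prependZero T) ≡ true ⇔ isSSYT T ≡ true
      ssyt-prependZero T∈ near =
        let eq = isSSYT-prependZero-near k ks D+S≤k T∈ near in mk⇔ (trans (sym eq)) (trans eq)

  coeff-schur-suc : ∀ ls ks {k a} (w : Vec ℕ m) → D + sum ks ≤ k → sum ls ℕ.* (k + sum ks) ≤ a + D →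
                    coeff (hSeqPleth (map +_ ls) (schur (suc m) (suc k ∷ ks))) ((sum ls + a) ∷ w) ≡
                    coeff (hSeqPleth (map +_ ls) (schur (suc m) (k ∷ ks))) (a ∷ w)
  coeff-schur-suc ls ks {k} {a} w D+S≤k near = begin
      coeff (H (schur (suc m) (suc k ∷ ks))) (x₁^ L · t)
    ≡⟨ coeff-near ls (schur-Deg₁≤ m (suc k ∷ ks)) near-shifted ⟩
      coeff (H (filter (near? (suc U)) (schur (suc m) (suc k ∷ ks)))) (x₁^ L · t)
    ≡⟨ cong (λ f → coeff (H f) (x₁^ L · t)) (schur-near-suc k ks D+S≤k) ⟩
      coeff (H (map (x₁^ 1 ·_) S₀)) (x₁^ L · t)
    ≡⟨ cong (λ P → coeff P (x₁^ L · t)) (hSeqPleth-x₁^ ls S₀) ⟩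
      coeff (map (x₁^ L ·_) (H S₀)) (x₁^ L · t)
    ≡⟨ coeff-map-injective (x₁^-injective L) (H S₀) t ⟩
      coeff (H S₀) t
    ≡⟨ coeff-near ls (schur-Deg₁≤ m (k ∷ ks)) near ⟨
      coeff (H (schur (suc m) (k ∷ ks))) t ∎
    where
      open ≡-Reasoning
      L = sum ls
      U = k + sum ks
      t : Mono (suc m)
      t = a ∷ w
      H : Poly (suc m) → Poly (suc m)
      H = hSeqPleth (map +_ ls)
      S₀ = filter (near? U) (schur (suc m) (k ∷ ks))
      near-shifted : Near (L ℕ.* suc U) (x₁^ L · t)
      near-shifted = subst₂ _≤_ (sym (*-suc L U)) (sym (+-assoc L a D)) (+-monoʳ-≤ L near)

plethCoeff-suc : ∀ ls ks D k a ν → D + sum ks ≤ k → sum ls ℕ.* (k + sum ks) ≤ a + D →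
                 plethCoeff (map +_ ls) (suc k ∷ ks) (+ (sum ls + a) ∷ ν) ≡ plethCoeff (map +_ ls) (k ∷ ks) (+ a ∷ ν)
plethCoeff-suc ls ks D k a ν D+S≤k near with toNatVec (Vec.fromList ν)
... | nothing = refl
... | just w  = Nearness.coeff-schur-suc D ls ks w D+S≤k near

module _ {b : ℕ → ℕ} where

  eventuallyConstant-cong : ∀ {b′} → (∀ n → b n ≡ b′ n) → EventuallyConstant b′ → EventuallyConstant b
  eventuallyConstant-cong b≡b′ (N , const) = N , λ n N≤n → trans (b≡b′ n) (trans (const n N≤n) (sym (b≡b′ N)))

  eventuallyConstant-step : ∀ N → (∀ n → N ≤ n → b (suc n) ≡ b n) → EventuallyConstant b
  eventuallyConstant-step N step = N , λ n N≤n → subst (λ n → b n ≡ b N) (m∸n+n≡m N≤n) (beyond (n ∸ N))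
    where
      beyond : ∀ d → b (d + N) ≡ b N
      beyond zero    = refl
      beyond (suc d) = trans (step (d + N) (m≤n+m N d)) (beyond d)

  eventuallyConstant-shift : ∀ N → EventuallyConstant (λ n → b (N + n)) → EventuallyConstant b
  eventuallyConstant-shift N (M , const) = N + M , λ n N+M≤n →
    let N≤n = ≤-trans (m≤m+n N M) N+M≤n
        n≡N+d = sym (m+[n∸m]≡n N≤n)
    in trans (cong b n≡N+d) (const (n ∸ N) (+-cancelˡ-≤ N M (n ∸ N) (subst (N + M ≤_) n≡N+d N+M≤n)))

plethCoeff-stable : ∀ ls c ks z ν →
                    EventuallyConstant (λ n → plethCoeff (map +_ ls) ((c + n) ∷ ks) (+ (z + sum ls ℕ.* n) ∷ ν))
plethCoeff-stable ls c ks z ν = eventuallyConstant-step (D + sum ks) step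
  where
    L = sum ls
    -- the shortfall L·(c + n + |ks|) − (z + L·n) never exceeds D
    D = L ℕ.* (c + sum ks)
    step : ∀ n → D + sum ks ≤ n →
           plethCoeff (map +_ ls) ((c + suc n) ∷ ks) (+ (z + L ℕ.* suc n) ∷ ν) ≡
           plethCoeff (map +_ ls) ((c + n) ∷ ks) (+ (z + L ℕ.* n) ∷ ν)
    step n D+S≤n = begin
        plethCoeff (map +_ ls) ((c + suc n) ∷ ks) (+ (z + L ℕ.* suc n) ∷ ν)
      ≡⟨ cong₂ (λ k a → plethCoeff (map +_ ls) (k ∷ ks) (+ a ∷ ν)) (+-suc c n) (shift-first-entry z L n) ⟩
        plethCoeff (map +_ ls) (suc (c + n) ∷ ks) (+ (L + (z + L ℕ.* n)) ∷ ν)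
      ≡⟨ plethCoeff-suc ls ks D (c + n) (z + L ℕ.* n) ν (≤-trans D+S≤n (m≤n+m n c)) near ⟩
        plethCoeff (map +_ ls) ((c + n) ∷ ks) (+ (z + L ℕ.* n) ∷ ν) ∎
      where
        open ≡-Reasoning
        shift-first-entry : ∀ z L n → z + L ℕ.* suc n ≡ L + (z + L ℕ.* n)
        shift-first-entry = solve-∀
        distribute : ∀ L c n S → L ℕ.* (c + n + S) ≡ L ℕ.* n + L ℕ.* (c + S)
        distribute = solve-∀
        near : L ℕ.* (c + n + sum ks) ≤ z + L ℕ.* n + D
        near = subst₂ _≤_ (sym (distribute L c n (sum ks))) (sym (+-assoc z (L ℕ.* n) D)) (m≤n+m _ z)

-[1+j]+[1+j+m] : ∀ j m → -[1+ j ] ℤ.+ + (suc j + m) ≡ + m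
-[1+j]+[1+j+m] j m = trans (ℤₚ.⊖-≥ (m≤m+n (suc j) m)) (cong +_ (m+n∸m≡n (suc j) m))

plethCoeff-stableℤ : ∀ ls c ks x ν →
                     EventuallyConstant (λ n → plethCoeff (map +_ ls) ((c + n) ∷ ks) ((x ℤ.+ + (sum ls ℕ.* n)) ∷ ν))
plethCoeff-stableℤ ls c ks (+ z)    ν = plethCoeff-stable ls c ks z ν
plethCoeff-stableℤ ls c ks -[1+ j ] ν with sum ls in L≡
... | zero  = eventuallyConstant-step 0 (λ _ _ → refl)
... | suc L = eventuallyConstant-shift (suc j)
                (eventuallyConstant-cong first-entry (plethCoeff-stable ls (c + suc j) ks (L ℕ.* suc j) ν))
  where
    first-entry : ∀ n →
      plethCoeff (map +_ ls) ((c + (suc j + n)) ∷ ks) ((-[1+ j ] ℤ.+ + (suc L ℕ.* (suc j + n))) ∷ ν) ≡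
      plethCoeff (map +_ ls) ((c + suc j + n) ∷ ks) (+ (L ℕ.* suc j + sum ls ℕ.* n) ∷ ν)
    first-entry n rewrite L≡ = cong₂ (λ k x → plethCoeff (map +_ ls) (k ∷ ks) (x ∷ ν))
      (sym (+-assoc c (suc j) n))
      (trans (cong (λ e → -[1+ j ] ℤ.+ + e) (expand L j n)) (-[1+j]+[1+j+m] j (L ℕ.* suc j + suc L ℕ.* n)))
      where
        expand : ∀ L j n → suc L ℕ.* (suc j + n) ≡ suc j + (L ℕ.* suc j + suc L ℕ.* n)
        expand = solve-∀

*P-[] : ∀ {m} (X : Poly m) → X *P [] ≡ []
*P-[] []      = refl
*P-[] (_ ∷ X) = *P-[] X

natural-or-vanishing : ∀ λs → (∃ λ ls → λs ≡ map +_ ls) ⊎ (∀ {m} (f : Poly m) → hSeqPleth λs f ≡ [])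
natural-or-vanishing []               = inj₁ ([] , refl)
natural-or-vanishing (-[1+ _ ] ∷ _)   = inj₂ (λ _ → refl)
natural-or-vanishing (+ r ∷ λs) with natural-or-vanishing λs
... | inj₁ (ls , refl) = inj₁ (r ∷ ls , refl)
... | inj₂ vanishes    = inj₂ (λ f → trans (cong (hPleth r f *P_) (vanishes f)) (*P-[] (hPleth r f)))

plethCoeff-vanishing : ∀ {λs} → (∀ {m} (f : Poly m) → hSeqPleth λs f ≡ []) → ∀ μ ν → plethCoeff λs μ ν ≡ 0
plethCoeff-vanishing vanishes μ ν with toNatVec (Vec.fromList ν)
... | nothing = refl
... | just a rewrite vanishes (schur (length ν) μ) = refl

addFirstℕ-form : ∀ μ → ∃₂ λ c ks → ∀ n → addFirstℕ μ n ≡ (c + n) ∷ ks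
addFirstℕ-form []       = 0 , [] , λ _ → refl
addFirstℕ-form (c ∷ ks) = c , ks , λ _ → refl

addFirstℤ-form : ∀ ν → ∃₂ λ x ν′ → ∀ k → addFirstℤ ν k ≡ (x ℤ.+ k) ∷ ν′
addFirstℤ-form []      = + 0 , [] , λ k → cong (_∷ []) (sym (ℤₚ.+-identityˡ k))
addFirstℤ-form (x ∷ ν) = x , ν , λ _ → refl

sizeℤ-map : ∀ ls → sizeℤ (map +_ ls) ≡ + sum ls
sizeℤ-map []       = refl
sizeℤ-map (r ∷ ls) = cong (ℤ._+_ (+ r)) (sizeℤ-map ls)

theorem3p3 : (μ : List ℕ) → IsPartition μ → (λs ν : List ℤ) →
    EventuallyConstant (λ n → plethCoeff λs (addFirstℕ μ n) (addFirstℤ ν (sizeℤ λs * + n)))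
theorem3p3 μ _ λs ν with natural-or-vanishing λs
... | inj₂ vanishes = eventuallyConstant-cong
  (λ n → plethCoeff-vanishing vanishes (addFirstℕ μ n) (addFirstℤ ν (sizeℤ λs * + n))) (0 , λ _ _ → refl)
... | inj₁ (ls , refl) with addFirstℕ-form μ | addFirstℤ-form ν
...   | c , ks , μ≡ | x , ν′ , ν≡ = eventuallyConstant-cong normalise (plethCoeff-stableℤ ls c ks x ν′)
  where
    normalise : ∀ n → plethCoeff (map +_ ls) (addFirstℕ μ n) (addFirstℤ ν (sizeℤ (map +_ ls) * + n)) ≡
                      plethCoeff (map +_ ls) ((c + n) ∷ ks) ((x ℤ.+ + (sum ls ℕ.* n)) ∷ ν′)
    normalise n = cong₂ (plethCoeff (map +_ ls)) (μ≡ n) (trans (ν≡ _) (cong (λ k → (x ℤ.+ k) ∷ ν′)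
      (trans (cong (_* + n) (sizeℤ-map ls)) (sym (ℤₚ.pos-* (sum ls) n)))))
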